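{- Let $G=(V,E)$ be a DAG and let $(s_1,t_1),\dots,(s_p,t_p)$ be demand pairs with $t_i$ reachable from $s_i$ in $G$. Start with $H=(V,\emptyset)$, and for $i=1,\dots,p$ generate a path $\pi(s_i,t_i)$ with \texttt{forwards-growth} (respectively, always with \texttt{backwards-growth}) applied to $G$, the current $H$ and $(s_i,t_i)$, then add its edges to $H$. Let $Z=(V,\Pi)$ be the associated ordered path system. Then: (1) $Z$ is acyclic; (2) $\|Z\|=|E(H)|+p$, where $H$ is the final preserver; (3) under \texttt{forwards-growth}, $Z$ contains no bridge (of any size) in which the first arc comes before the river in the ordering of $\Pi$; under \texttt{backwards-growth}, $Z$ contains no bridge in which the last arc comes before the river in the ordering of $\Pi$.
   Context: \texttt{forwards-growth}$(G,H,(s,t))$: start with $\pi=(s)$; while the last node $u$ of $\pi$ is not $t$: if there is an edge $(u,v)\in E(H)$ with $t$ reachable from $v$ in $G$, append any such $v$; otherwise append any $v$ with $(u,v)\in E(G)$ and $t$ reachable from $v$. \texttt{backwards-growth}$(G,H,(s,t))$: start with $\pi=(t)$; while the first node $v$ of $\pi$ is not $s$: if there is $(u,v)\in E(H)$ with $u$ reachable from $s$, prepend any such $u$; otherwise prepend any $u$ with $(u,v)\in E(G)$ and $u$ reachable from $s$. (Choices among "any such" edges are arbitrary.) A path system is a pair $(V,\Pi)$ where $\Pi$ is a collection of nonempty vertex sequences (paths); $|\pi|$ is the number of vertices of $\pi$ and the size is $\|S\|=\sum_{\pi\in\Pi}|\pi|$. An ordered path system additionally has a total order on $\Pi$. When $\pi(s,t)$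 is added to $H$, an edge of it is new if it was not previously in $H$; the path added to $Z$ is, under \texttt{forwards-growth}, $\{u:(u,v)\text{ a new edge of }\pi(s,t)\}\cup\{t\}$, and under \texttt{backwards-growth}, $\{s\}\cup\{v:(u,v)\text{ a new edge of }\pi(s,t)\}$, with these nodes ordered as in $\pi(s,t)$; paths of $Z$ are ordered by the arrival order of their demand pairs. A subsystem is obtained by repeatedly deleting a path, deleting a node, or deleting one occurrence of a node from a path. A $k$-bridge is a path system with nodes $x_1,\dots,x_k$ and $k$ two-node paths: the river $(x_1,x_k)$ and, for $1\le i<k$, the $i$-th arc $(x_i,x_{i+1})$ (the first arc is $(x_1,x_2)$, the last arc is $(x_{k-1},x_k)$); degenerate cases count (e.g. two paths sharing two nodes in the same order form a $2$-bridge). A system contains a bridge if some subsystem is a $k$-bridge for some $k\ge2$, with order on the bridge's paths inherited from $\Pi$. A path system is acyclic if there is a total order on $V$ with which the vertex order of every path agrees. -}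

module Defs where

open import Data.Nat using (ℕ; zero; suc)
open import Data.Fin as F using (Fin; zero; suc; inject₁; fromℕ; _≟_)
import Data.Fin.Properties as FP
open import Data.Product using (_×_; _,_; proj₁; proj₂; Σ; ∃; ∃-syntax)
open import Data.Product.Properties using (≡-dec)
open import Data.List using (List; []; _∷_; _++_; _∷ʳ_; length; map; filter; lookup; tabulate; deduplicate; removeAt)
open import Data.List.Membership.Propositional using (_∈_)
open import Data.List.Relation.Unary.Any using (any?)
open import Relation.Nullary using (Dec)
open import Data.Nat.ListAction using (sum)
open import Data.List.Relation.Binary.Permutation.Propositional using (_↭_)
open import Data.List.Relation.Unary.AllPairs using (AllPairs)
open import Data.List.Relation.Unary.All using (All)
open import Relation.Binary using (IsStrictTotalOrder; Rel)
open import Relation.Binary.PropositionalEquality using (_≡_; _≢_)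
open import Relation.Binary.Construct.Closure.ReflexiveTransitive using (Star)
open import Relation.Nullary using (¬_; ¬?; yes; no)
open import Function.Definitions using (Injective; Bijective)

-- Graphs on the vertex set V = Fin n, given by a list of directed edges.
-- Duplicates in the list are harmless: E(G) is the set of listed pairs.

Edge : ℕ → Set
Edge n = Fin n × Fin n

Graph : ℕ → Set
Graph n = List (Edge n)

numEdges : ∀ {n} → Graph n → ℕ
numEdges H = length (deduplicate (≡-dec _≟_ _≟_) H)

_∈E?_ : ∀ {n} (e : Edge n) (H : Graph n) → Dec (e ∈ H)
e ∈E? H = any? (≡-dec _≟_ _≟_ e) H

Reach : ∀ {n} → Graph n → Fin n → Fin n → Set
Reach G = Star (λ u v → (u , v) ∈ G)

DAG : ∀ {n} → Graph n → Set
DAG {n} G = ∀ (u v : Fin n) → (u , v) ∈ G → ¬ Reach G v u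

edges : ∀ {n} → List (Fin n) → Graph n
edges []            = []
edges (u ∷ [])      = []
edges (u ∷ v ∷ π)   = (u , v) ∷ edges (v ∷ π)

-- forwards-growth(G,H,(s,t)) as a relation (arbitrary choices allowed).
-- FwdFrom G H t u π : running the loop from current last node u yields
-- the remaining sequence π (starting with u, ending with t).

data FwdFrom {n} (G H : Graph n) (t : Fin n) : Fin n → List (Fin n) → Set where
  arrive : FwdFrom G H t t (t ∷ [])
  viaH   : ∀ {u v π} → u ≢ t → (u , v) ∈ H → Reach G v t →
           FwdFrom G H t v π → FwdFrom G H t u (u ∷ π)
  viaG   : ∀ {u v π} → u ≢ t →
           (∀ w → (u , w) ∈ H → ¬ Reach G w t) →
           (u , v) ∈ G → Reach G v t →
           FwdFrom G H t v π → FwdFrom G H t u (u ∷ π)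

forwardsGrowth : ∀ {n} → Graph n → Graph n → Fin n × Fin n → List (Fin n) → Set
forwardsGrowth G H (s , t) π = FwdFrom G H t s π

-- backwards-growth(G,H,(s,t)) as a relation.
-- BwdTo G H s v π : running the loop from current first node v yields
-- the sequence π (starting with s, ending with v).

data BwdTo {n} (G H : Graph n) (s : Fin n) : Fin n → List (Fin n) → Set where
  depart : BwdTo G H s s (s ∷ [])
  viaH   : ∀ {u v π} → v ≢ s → (u , v) ∈ H → Reach G s u →
           BwdTo G H s u π → BwdTo G H s v (π ∷ʳ v)
  viaG   : ∀ {u v π} → v ≢ s →
           (∀ w → (w , v) ∈ H → ¬ Reach G s w) →
           (u , v) ∈ G → Reach G s u →
           BwdTo G H s u π → BwdTo G H s v (π ∷ʳ v)

backwardsGrowth : ∀ {n} → Graph n → Graph n → Fin n × Fin n → List (Fin n) → Set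
backwardsGrowth G H (s , t) π = BwdTo G H s t π

data Mode : Set where
  forwards backwards : Mode

Growth : Mode → ∀ {n} → Graph n → Graph n → Fin n × Fin n → List (Fin n) → Set
Growth forwards  = forwardsGrowth
Growth backwards = backwardsGrowth

-- The path added to Z, given the preserver H before adding π.

zTailsF : ∀ {n} → Graph n → Fin n → List (Fin n) → List (Fin n)
zTailsF H u []      = u ∷ []
zTailsF H u (v ∷ π) with (u , v) ∈E? H
... | yes _ = zTailsF H v π
... | no  _ = u ∷ zTailsF H v π

zPathF : ∀ {n} → Graph n → List (Fin n) → List (Fin n)
zPathF H []      = []
zPathF H (u ∷ π) = zTailsF H u π

zHeadsB : ∀ {n} → Graph n → Fin n → List (Fin n) → List (Fin n)
zHeadsB H u []      = []
zHeadsB H u (v ∷ π) with (u , v) ∈E? H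
... | yes _ = zHeadsB H v π
... | no  _ = v ∷ zHeadsB H v π

zPathB : ∀ {n} → Graph n → List (Fin n) → List (Fin n)
zPathB H []      = []
zPathB H (s ∷ π) = s ∷ zHeadsB H s π

zPath : Mode → ∀ {n} → Graph n → List (Fin n) → List (Fin n)
zPath forwards  = zPathF
zPath backwards = zPathB

-- Run m G H ds Z H' : starting from preserver H
-- and processing demand pairs ds in order, the paths added to Z are the
-- list Z (in arrival order) and the final preserver is H'.

data Run (m : Mode) {n} (G : Graph n) : Graph n → List (Fin n × Fin n) →
         List (List (Fin n)) → Graph n → Set where
  done : ∀ {H} → Run m G H [] [] H
  step : ∀ {H s t π ds Z H'} →
         Growth m G H (s , t) π →
         Run m G (H ++ edges π) ds Z H' →
         Run m G H ((s , t) ∷ ds) (zPath m H π ∷ Z) H'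

-- Ordered path systems: (vertex list, ordered list of paths).

PathSystem : ℕ → Set
PathSystem n = List (Fin n) × List (List (Fin n))

size : ∀ {n} → List (List (Fin n)) → ℕ
size Π = sum (map length Π)

Acyclic : ∀ {n} → List (List (Fin n)) → Set₁
Acyclic {n} Π = Σ (Rel (Fin n) _) λ _≺_ →
  IsStrictTotalOrder _≡_ _≺_ × All (AllPairs _≺_) Π

data _⇝_ {n} : PathSystem n → PathSystem n → Set where
  delPath : ∀ {vs ps₁ π ps₂} →
            (vs , ps₁ ++ π ∷ ps₂) ⇝ (vs , ps₁ ++ ps₂)
  delNode : ∀ {vs₁ x vs₂ ps} →
            (vs₁ ++ x ∷ vs₂ , ps) ⇝
            (vs₁ ++ vs₂ , map (filter (λ y → ¬? (y ≟ x))) ps)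
  delOcc  : ∀ {vs ps₁ π ps₂} (j : Fin (length π)) →
            (vs , ps₁ ++ π ∷ ps₂) ⇝ (vs , ps₁ ++ removeAt π j ∷ ps₂)

Subsystem : ∀ {n} → PathSystem n → PathSystem n → Set
Subsystem S S' = Star _⇝_ S S'

-- S is a k-bridge with k = 2 + m, nodes x₁..x_k = node 0 .. node (k-1).
-- slot r gives the position in the ordered path list of role r:
-- role zero is the river (x₁,x_k), role (suc i) is the (i+1)-th arc.
record Bridge {n} (m : ℕ) (S : PathSystem n) : Set where
  field
    node      : Fin (suc (suc m)) → Fin n
    node-inj  : Injective _≡_ _≡_ node
    vertices  : proj₁ S ↭ tabulate node
    slot      : Fin (suc (suc m)) → Fin (length (proj₂ S))
    slot-bij  : Bijective _≡_ _≡_ slot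
    river     : lookup (proj₂ S) (slot zero) ≡ node zero ∷ node (fromℕ (suc m)) ∷ []
    arc       : ∀ (i : Fin (suc m)) →
                lookup (proj₂ S) (slot (suc i)) ≡ node (inject₁ i) ∷ node (suc i) ∷ []

  firstArc lastArc : Fin (suc (suc m))
  firstArc = suc zero
  lastArc  = suc (fromℕ m)

BadOrder : Mode → ∀ {n m} {S : PathSystem n} → Bridge m S → Set
BadOrder forwards  b = Bridge.slot b (Bridge.firstArc b) F.< Bridge.slot b zero
BadOrder backwards b = Bridge.slot b (Bridge.lastArc b)  F.< Bridge.slot b zero

ContainsBadBridge : Mode → ∀ {n} → PathSystem n → Set
ContainsBadBridge md S = ∃[ S' ] (Subsystem S S' × ∃[ m ] Σ (Bridge m S') (BadOrder md))

{-# OPTIONS --safe #-}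
-- Each grown path π is a walk in G from s to t, and the path it adds to Z is a subsequence of π.
-- Hence the paths of Z agree with a topological order of G (rank vertices by the length of a
-- longest walk leaving them), and a path of Z has one vertex per new edge of π plus one endpoint,
-- these new edges being distinct because a walk in a DAG repeats no vertex.
-- Bridges, forwards: if x is followed by y on a path of Z, then π has a new edge (x, w) with
-- w ⇝ y; growth left x through a new edge, so the H of that moment had no edge (x, w′) with
-- w′ ⇝ t, hence none with w′ ⇝ y. If the first arc (x₁, x₂) comes before the river (x₁, x_k),
-- its edge (x₁, w) is in H when the river is grown, and w ⇝ x₂ ⇝ ⋯ ⇝ x_k along the arcs.
-- Backwards growth is the mirror image, with the last arc and the edges of H entering x_k.
module Submission where

open import Defs
open import Level using (Level; 0ℓ)
open import Data.Nat as ℕ using (ℕ; zero; suc; _+_; _≤_; _<_; s≤s; s<s)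
import Data.Nat.Properties as ℕ
open import Data.Fin as F using (Fin; zero; suc; inject₁; fromℕ; _≟_)
import Data.Fin.Properties as F
open import Data.Product using (_×_; _,_; proj₁; proj₂; ∃-syntax)
import Data.Product as Product
open import Data.Product.Properties using (≡-dec)
open import Data.Product.Relation.Binary.Lex.Strict using (×-Lex; ×-isStrictTotalOrder)
open import Data.Sum using (_⊎_; inj₁; inj₂)
import Data.Sum as Sum
open import Data.Empty using (⊥-elim)
open import Data.List
  using (List; []; _∷_; _++_; length; map; filter; lookup; removeAt; allFin; deduplicate)
open import Data.List.Properties using (length-++)
open import Data.List.Extrema.Nat using (max; xs≤max; argmax-sel)
open import Data.List.Membership.Propositional using (_∈_; _∉_)
open import Data.List.Membership.Propositional.Properties
  using ( ∈-lookup; ∈-map⁺; ∈-map⁻; ∈-filter⁺; ∈-filter⁻; ∈-++⁺ˡ; ∈-++⁺ʳ; ∈-++⁻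
        ; ∈-deduplicate⁺; ∈-deduplicate⁻)
open import Data.List.Membership.Propositional.Properties.WithK using (unique∧set⇒bag)
open import Data.List.Relation.Unary.Any using (Any; here; there)
open import Data.List.Relation.Unary.All using (All; []; _∷_)
import Data.List.Relation.Unary.All as All
open import Data.List.Relation.Unary.AllPairs using (AllPairs; []; _∷_)
import Data.List.Relation.Unary.AllPairs as AllPairs
open import Data.List.Relation.Unary.Unique.Propositional using (Unique)
import Data.List.Relation.Unary.Unique.Propositional.Properties as Unique
open import Data.List.Relation.Unary.Unique.DecPropositional.Properties using (deduplicate-!)
open import Data.List.Relation.Binary.BagAndSetEquality using (∼bag⇒↭)
open import Data.List.Relation.Binary.Permutation.Propositional.Properties using (↭-length)
open import Data.List.Relation.Binary.Subset.Propositional using () renaming (_⊆_ to _⊆ₛ_)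
open import Data.List.Relation.Binary.Sublist.Propositional
  using (_⊆_; []; _∷_; _∷ʳ_; ⊆-refl; ⊆-trans; ⊆-reflexive; from∈; to∈)
import Data.List.Relation.Binary.Sublist.Propositional as Sublist
open import Data.List.Relation.Binary.Sublist.Propositional.Properties using (∷ˡ⁻; filter-⊆)
import Data.List.Relation.Binary.Sublist.Heterogeneous as Hetero
import Data.List.Relation.Binary.Sublist.Heterogeneous.Properties as Hetero
open import Function using (id; _∘_; flip; _on_)
open import Function.Bundles using (_⇔_; mk⇔)
open import Relation.Binary
  using (Rel; Transitive; Trichotomous; tri<; tri≈; tri>; IsStrictTotalOrder; isStrictTotalOrderᶜ)
import Relation.Binary.Construct.Flip.EqAndOrd as Flip
open import Relation.Binary.Construct.Closure.ReflexiveTransitive using (Star; ε; _◅_; _◅◅_)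
open import Relation.Binary.PropositionalEquality
  using (_≡_; _≢_; refl; sym; trans; cong; subst; isEquivalence; module ≡-Reasoning)
open import Relation.Nullary using (¬_; Dec; yes; no; ¬?)

private
  variable
    a p r : Level
    A : Set a

[]⊆ₛ : ∀ {xs : List A} → [] ⊆ₛ xs
[]⊆ₛ ()

All-resp-Sublist : ∀ {R : Rel A r} {P : A → Set p} → (∀ {x y} → R x y → P y → P x) →
                   ∀ {xs ys} → Hetero.Sublist R xs ys → All P ys → All P xs
All-resp-Sublist resp []        []         = []
All-resp-Sublist resp (_ ∷ʳ τ)  (_ ∷ pys)  = All-resp-Sublist resp τ pys
All-resp-Sublist resp (xRy ∷ τ) (py ∷ pys) = resp xRy py ∷ All-resp-Sublist resp τ pys

AllPairs-resp-⊆ : ∀ {R : Rel A r} {xs ys} → xs ⊆ ys → AllPairs R ys → AllPairs R xs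
AllPairs-resp-⊆ []         []         = []
AllPairs-resp-⊆ (_ ∷ʳ τ)   (_ ∷ pys)  = AllPairs-resp-⊆ τ pys
AllPairs-resp-⊆ (refl ∷ τ) (py ∷ pys) =
  All-resp-Sublist (λ { refl pz → pz }) τ py ∷ AllPairs-resp-⊆ τ pys

AllPairs-lookup : ∀ {R : Rel A r} {xs} → AllPairs R xs →
                  ∀ {i j} → i F.< j → R (lookup xs i) (lookup xs j)
AllPairs-lookup (px ∷ _)  {zero}  {suc j} _         = All.lookup px (∈-lookup j)
AllPairs-lookup (_ ∷ pxs) {suc i} {suc j} (s<s i<j) = AllPairs-lookup pxs i<j

lookup-⊆ : ∀ {xs : List A} {i j} → i F.< j → (lookup xs i ∷ lookup xs j ∷ []) ⊆ xs
lookup-⊆ {xs = x ∷ xs} {zero}  {suc j} _         = refl ∷ from∈ (∈-lookup j)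
lookup-⊆ {xs = x ∷ xs} {suc i} {suc j} (s<s i<j) = x ∷ʳ lookup-⊆ i<j

removeAt-⊆ : ∀ (xs : List A) i → removeAt xs i ⊆ xs
removeAt-⊆ (x ∷ xs) zero    = x ∷ʳ ⊆-refl
removeAt-⊆ (x ∷ xs) (suc i) = refl ∷ removeAt-⊆ xs i

map-⊆ : ∀ {f : List A → List A} → (∀ xs → f xs ⊆ xs) → ∀ xss → Hetero.Sublist _⊆_ (map f xss) xss
map-⊆ f⊆ []         = Hetero.[]
map-⊆ f⊆ (xs ∷ xss) = f⊆ xs Hetero.∷ map-⊆ f⊆ xss

unique-same-members⇒length≡ : ∀ {xs ys : List A} → Unique xs → Unique ys →
                               (∀ {z} → z ∈ xs ⇔ z ∈ ys) → length xs ≡ length ys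
unique-same-members⇒length≡ uxs uys same = ↭-length (∼bag⇒↭ (unique∧set⇒bag uxs uys same))

Star-chain : ∀ {R : Rel A r} m (f : Fin (suc m) → A) →
             (∀ i → Star R (f (inject₁ i)) (f (suc i))) → Star R (f zero) (f (fromℕ m))
Star-chain zero    f steps = ε
Star-chain (suc m) f steps = Star-chain m (f ∘ inject₁) (steps ∘ inject₁) ◅◅ steps (fromℕ m)

module _ {b ℓ₁ ℓ₂ : Level} {B : Set b} {_≈_ : Rel B ℓ₁} {_<_ : Rel B ℓ₂} where

  isStrictTotalOrder-on : IsStrictTotalOrder _≈_ _<_ → (f : A → B) →
                          (∀ {x y} → f x ≈ f y → x ≡ y) → IsStrictTotalOrder _≡_ (_<_ on f)
  isStrictTotalOrder-on sto f f-inj = isStrictTotalOrderᶜ record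
    { isEquivalence = isEquivalence
    ; trans         = S.trans
    ; compare       = compare
    }
    where
    module S = IsStrictTotalOrder sto
    compare : Trichotomous _≡_ (_<_ on f)
    compare x y with S.compare (f x) (f y)
    ... | tri< lt ¬eq ¬gt = tri< lt (¬eq ∘ S.Eq.reflexive ∘ cong f) ¬gt
    ... | tri≈ ¬lt eq ¬gt = tri≈ ¬lt (f-inj eq) ¬gt
    ... | tri> ¬lt ¬eq gt = tri> ¬lt (¬eq ∘ S.Eq.reflexive ∘ cong f) gt

∈-edges⇒proj₁∈ : ∀ {n} {e : Edge n} π → e ∈ edges π → proj₁ e ∈ π
∈-edges⇒proj₁∈ (x ∷ y ∷ π) (here refl) = here refl
∈-edges⇒proj₁∈ (x ∷ y ∷ π) (there m)   = there (∈-edges⇒proj₁∈ (y ∷ π) m)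

edges-unique : ∀ {n} {π : List (Fin n)} → Unique π → Unique (edges π)
edges-unique {π = []}        []           = []
edges-unique {π = x ∷ []}    _            = []
edges-unique {π = x ∷ y ∷ π} (x∉ ∷ uniq) = All.tabulate new ∷ edges-unique uniq
  where
  new : ∀ {e} → e ∈ edges (y ∷ π) → (x , y) ≢ e
  new m refl = All.lookup x∉ (∈-edges⇒proj₁∈ (y ∷ π) m) refl

∈-edges-∷ʳ⁻ : ∀ {n} {e : Edge n} {u v} ρ → e ∈ edges ((ρ ++ u ∷ []) ++ v ∷ []) →
              e ∈ edges (ρ ++ u ∷ []) ⊎ e ≡ (u , v)
∈-edges-∷ʳ⁻ []          (here refl) = inj₂ refl
∈-edges-∷ʳ⁻ (a ∷ [])    (here refl) = inj₁ (here refl)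
∈-edges-∷ʳ⁻ (a ∷ [])    (there m)   = Sum.map₁ there (∈-edges-∷ʳ⁻ [] m)
∈-edges-∷ʳ⁻ (a ∷ b ∷ ρ) (here refl) = inj₁ (here refl)
∈-edges-∷ʳ⁻ (a ∷ b ∷ ρ) (there m)   = Sum.map₁ there (∈-edges-∷ʳ⁻ (b ∷ ρ) m)

-- Walks

module _ {n : ℕ} (G : Graph n) where

  data Walk : Fin n → Fin n → List (Fin n) → Set where
    [_] : ∀ x → Walk x x (x ∷ [])
    _∷_ : ∀ {x y z π} → (x , y) ∈ G → Walk y z (y ∷ π) → Walk x z (x ∷ y ∷ π)

  Reach⁺ : Fin n → Fin n → Set
  Reach⁺ x y = ∃[ w ] ((x , w) ∈ G × Reach G w y)

module _ {n : ℕ} {G : Graph n} where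

  walk-∷ : ∀ {x y z π} → (x , y) ∈ G → Walk G y z π → Walk G x z (x ∷ π)
  walk-∷ e w@([ _ ]) = e ∷ w
  walk-∷ e w@(_ ∷ _) = e ∷ w

  walk-head : ∀ {x y π} → Walk G x y π → ∃[ ρ ] (π ≡ x ∷ ρ)
  walk-head [ x ]   = _ , refl
  walk-head (e ∷ w) = _ , refl

  walk-∷ʳ : ∀ {x y z π} → Walk G x y π → (y , z) ∈ G → Walk G x z (π ++ z ∷ [])
  walk-∷ʳ [ x ]   e = e ∷ [ _ ]
  walk-∷ʳ (d ∷ w) e = d ∷ walk-∷ʳ w e

  walk-edges⊆ : ∀ {x y π} → Walk G x y π → edges π ⊆ₛ G
  walk-edges⊆ (e ∷ w) (here refl) = e
  walk-edges⊆ (e ∷ w) (there m)   = walk-edges⊆ w m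

  walk-start-reaches : ∀ {x y z π} → Walk G x y π → z ∈ π → Reach G x z
  walk-start-reaches [ x ]   (here refl) = ε
  walk-start-reaches (e ∷ w) (here refl) = ε
  walk-start-reaches (e ∷ w) (there m)   = e ◅ walk-start-reaches w m

  walk-reaches-end : ∀ {x y z π} → Walk G x y π → z ∈ π → Reach G z y
  walk-reaches-end [ x ]   (here refl) = ε
  walk-reaches-end (e ∷ w) (here refl) = e ◅ walk-reaches-end w (here refl)
  walk-reaches-end (e ∷ w) (there m)   = walk-reaches-end w m

  walk⇒AllPairs : ∀ {R : Rel (Fin n) r} → Transitive R → (∀ {u v} → (u , v) ∈ G → R u v) →
                  ∀ {x y π} → Walk G x y π → AllPairs R π
  walk⇒AllPairs R-trans edge [ x ] = [] ∷ []
  walk⇒AllPairs R-trans edge (e ∷ w) with walk⇒AllPairs R-trans edge w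
  ... | rest@(y<ρ ∷ _) = (edge e ∷ All.map (R-trans (edge e)) y<ρ) ∷ rest

  Reach⁺-trans : Transitive (Reach⁺ G)
  Reach⁺-trans (w , e , r) (w′ , e′ , r′) = w , e , r ◅◅ (e′ ◅ r′)

module _ {n : ℕ} {G : Graph n} (dag : DAG G) where

  walk-unique : ∀ {x y π} → Walk G x y π → Unique π
  walk-unique w = AllPairs.map Reach⁺⇒≢ (walk⇒AllPairs Reach⁺-trans (λ e → _ , e , ε) w)
    where
    Reach⁺⇒≢ : ∀ {x y} → Reach⁺ G x y → x ≢ y
    Reach⁺⇒≢ (w , e , r) refl = dag _ w e r

  walk-length≤ : ∀ {x y π} → Walk G x y π → length π ≤ n
  walk-length≤ {π = π} w = ℕ.≮⇒≥ λ n<len →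
    let i , j , i<j , same = F.pigeonhole n<len (lookup π) in
    AllPairs-lookup (walk-unique w) i<j same

-- A topological order of a DAG

module _ {n : ℕ} (G : Graph n) where

  successors : Fin n → List (Fin n)
  successors u = map proj₂ (filter (λ e → proj₁ e ≟ u) G)

  height : ℕ → Fin n → ℕ
  height zero    u = 0
  height (suc k) u = max 0 (map (suc ∘ height k) (successors u))

module _ {n : ℕ} {G : Graph n} where

  ∈-successors⁺ : ∀ {u v} → (u , v) ∈ G → v ∈ successors G u
  ∈-successors⁺ {u} e = ∈-map⁺ proj₂ (∈-filter⁺ (λ e → proj₁ e ≟ u) e refl)

  ∈-successors⁻ : ∀ {u v} → v ∈ successors G u → (u , v) ∈ G
  ∈-successors⁻ {u} m with ∈-map⁻ proj₂ m
  ... | _ , e∈ , refl with ∈-filter⁻ (λ e → proj₁ e ≟ u) e∈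
  ...   | e , refl = e

  height-edge : ∀ k {u v} → (u , v) ∈ G → suc (height G k v) ≤ height G (suc k) u
  height-edge k e = All.lookup (xs≤max 0 _) (∈-map⁺ (suc ∘ height G k) (∈-successors⁺ e))

  height-attained : ∀ k u → height G (suc k) u ≡ 0 ⊎
                    ∃[ v ] ((u , v) ∈ G × height G (suc k) u ≡ suc (height G k v))
  height-attained k u with argmax-sel id 0 (map (suc ∘ height G k) (successors G u))
  ... | inj₁ eq = inj₁ eq
  ... | inj₂ m with ∈-map⁻ (suc ∘ height G k) m
  ...   | v , v∈ , eq = inj₂ (v , ∈-successors⁻ v∈ , eq)

  height-walk : ∀ k u → ∃[ y ] ∃[ π ] (Walk G u y π × length π ≡ suc (height G k u))
  height-walk zero    u = u , _ , [ u ] , refl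
  height-walk (suc k) u with height-attained k u
  ... | inj₁ eq = u , _ , [ u ] , cong suc (sym eq)
  ... | inj₂ (v , e , eq) with height-walk k v
  ...   | y , π , w , len = y , u ∷ π , walk-∷ e w , cong suc (trans len (sym eq))

  height-jump : ∀ k u → height G k u < height G (suc k) u → height G (suc k) u ≡ suc k
  height-jump k u grows with height-attained k u
  ... | inj₁ eq = ⊥-elim (ℕ.n≮0 (subst (height G k u <_) eq grows))
  height-jump zero    u grows | inj₂ (v , e , eq) = eq
  height-jump (suc k) u grows | inj₂ (v , e , eq) = trans eq (cong suc (height-jump k v v-grows))
    where
    v-grows : height G k v < height G (suc k) v
    v-grows = ℕ.s<s⁻¹ (ℕ.≤-<-trans (height-edge k e) (subst (height G (suc k) u <_) eq grows))

  height-stable : DAG G → ∀ u → height G (suc n) u ≤ height G n u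
  height-stable dag u = ℕ.≮⇒≥ λ grows →
    let _ , π , w , len = height-walk (suc n) u in
    ℕ.1+n≰n (ℕ.≤-trans (ℕ.n≤1+n _)
      (subst (_≤ n) (trans len (cong suc (height-jump n u grows))) (walk-length≤ dag w)))

module _ {n : ℕ} (G : Graph n) where

  -- height G k stops growing at k = n, since a walk in a DAG has at most n vertices.
  rank : Fin n → ℕ
  rank = height G (suc n)

  -- u ≺ v iff v has the smaller rank, or the same rank and the smaller index.
  _≺_ : Rel (Fin n) 0ℓ
  _≺_ = flip (×-Lex _≡_ _<_ F._<_ on λ u → rank u , u)

  ≺-isStrictTotalOrder : IsStrictTotalOrder _≡_ _≺_
  ≺-isStrictTotalOrder = Flip.isStrictTotalOrder
    (isStrictTotalOrder-on (×-isStrictTotalOrder ℕ.<-isStrictTotalOrder F.<-isStrictTotalOrder)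
                           (λ u → rank u , u) proj₂)

  ≺-edge : DAG G → ∀ {u v} → (u , v) ∈ G → u ≺ v
  ≺-edge dag {u} {v} e = inj₁ (ℕ.≤-trans (s≤s (height-stable dag v)) (height-edge n e))

module _ {n : ℕ} {G H : Graph n} where

  fwd-head : ∀ {t u π} → FwdFrom G H t u π → ∃[ ρ ] (π ≡ u ∷ ρ)
  fwd-head arrive             = _ , refl
  fwd-head (viaH _ _ _ _)     = _ , refl
  fwd-head (viaG _ _ _ _ _)   = _ , refl

  fwd-walk : H ⊆ₛ G → ∀ {t u π} → FwdFrom G H t u π → Walk G u t π
  fwd-walk H⊆G arrive             = [ _ ]
  fwd-walk H⊆G (viaH _ h _ f)     = walk-∷ (H⊆G h) (fwd-walk H⊆G f)
  fwd-walk H⊆G (viaG _ _ e _ f)   = walk-∷ e (fwd-walk H⊆G f)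

  fwd-new-edge⇒¬H-exit : ∀ {t u π x y} → FwdFrom G H t u π → (x , y) ∈ edges π → (x , y) ∉ H →
                         ∀ {w} → (x , w) ∈ H → ¬ Reach G w t
  fwd-new-edge⇒¬H-exit (viaH _ h _ f) m new with fwd-head f
  ... | _ , refl with m
  ...   | here refl = ⊥-elim (new h)
  ...   | there m′  = fwd-new-edge⇒¬H-exit f m′ new
  fwd-new-edge⇒¬H-exit (viaG _ noH _ _ f) m new with fwd-head f
  ... | _ , refl with m
  ...   | here refl = noH _
  ...   | there m′  = fwd-new-edge⇒¬H-exit f m′ new

  bwd-last : ∀ {s v π} → BwdTo G H s v π → ∃[ ρ ] (π ≡ ρ ++ v ∷ [])
  bwd-last depart           = [] , refl
  bwd-last (viaH _ _ _ _)   = _ , refl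
  bwd-last (viaG _ _ _ _ _) = _ , refl

  bwd-walk : H ⊆ₛ G → ∀ {s v π} → BwdTo G H s v π → Walk G s v π
  bwd-walk H⊆G depart           = [ _ ]
  bwd-walk H⊆G (viaH _ h _ b)   = walk-∷ʳ (bwd-walk H⊆G b) (H⊆G h)
  bwd-walk H⊆G (viaG _ _ e _ b) = walk-∷ʳ (bwd-walk H⊆G b) e

  bwd-new-edge⇒¬H-entry : ∀ {s v π x y} → BwdTo G H s v π → (x , y) ∈ edges π → (x , y) ∉ H →
                          ∀ {w} → (w , y) ∈ H → ¬ Reach G s w
  bwd-new-edge⇒¬H-entry (viaH _ h _ b) m new with bwd-last b
  ... | ρ , refl with ∈-edges-∷ʳ⁻ ρ m
  ...   | inj₁ m′   = bwd-new-edge⇒¬H-entry b m′ new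
  ...   | inj₂ refl = ⊥-elim (new h)
  bwd-new-edge⇒¬H-entry (viaG _ noH _ _ b) m new with bwd-last b
  ... | ρ , refl with ∈-edges-∷ʳ⁻ ρ m
  ...   | inj₁ m′   = bwd-new-edge⇒¬H-entry b m′ new
  ...   | inj₂ refl = noH _

module _ {n : ℕ} (H : Graph n) where

  newEdges : Graph n → Graph n
  newEdges = filter (λ e → ¬? (e ∈E? H))

  zTailsF-⊆ : ∀ u ρ → zTailsF H u ρ ⊆ u ∷ ρ
  zTailsF-⊆ u []      = refl ∷ []
  zTailsF-⊆ u (v ∷ ρ) with (u , v) ∈E? H
  ... | yes _ = u ∷ʳ zTailsF-⊆ v ρ
  ... | no _  = refl ∷ zTailsF-⊆ v ρ

  zHeadsB-⊆ : ∀ u ρ → zHeadsB H u ρ ⊆ ρ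
  zHeadsB-⊆ u []      = []
  zHeadsB-⊆ u (v ∷ ρ) with (u , v) ∈E? H
  ... | yes _ = v ∷ʳ zHeadsB-⊆ v ρ
  ... | no _  = refl ∷ zHeadsB-⊆ v ρ

  zPath-⊆ : ∀ md π → zPath md H π ⊆ π
  zPath-⊆ forwards  []      = []
  zPath-⊆ forwards  (u ∷ ρ) = zTailsF-⊆ u ρ
  zPath-⊆ backwards []      = []
  zPath-⊆ backwards (u ∷ ρ) = refl ∷ zHeadsB-⊆ u ρ

  ∈-zPath⁻ : ∀ md π {y} → y ∈ zPath md H π → y ∈ π
  ∈-zPath⁻ md π = Sublist.lookup (zPath-⊆ md π)

  zTailsF-length : ∀ u ρ → length (zTailsF H u ρ) ≡ suc (length (newEdges (edges (u ∷ ρ))))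
  zTailsF-length u []      = refl
  zTailsF-length u (v ∷ ρ) with (u , v) ∈E? H
  ... | yes _ = zTailsF-length v ρ
  ... | no _  = cong suc (zTailsF-length v ρ)

  zHeadsB-length : ∀ u ρ → length (zHeadsB H u ρ) ≡ length (newEdges (edges (u ∷ ρ)))
  zHeadsB-length u []      = refl
  zHeadsB-length u (v ∷ ρ) with (u , v) ∈E? H
  ... | yes _ = zHeadsB-length v ρ
  ... | no _  = cong suc (zHeadsB-length v ρ)

  zPath-length : ∀ md u ρ → length (zPath md H (u ∷ ρ)) ≡ suc (length (newEdges (edges (u ∷ ρ))))
  zPath-length forwards  u ρ = zTailsF-length u ρ
  zPath-length backwards u ρ = cong suc (zHeadsB-length u ρ)

module _ {n : ℕ} {G H : Graph n} where

  zPathF-pair⇒new-edge : ∀ {s t π x y} → Walk G s t π → (x ∷ y ∷ []) ⊆ zPathF H π →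
                         ∃[ w ] ((x , w) ∈ edges π × (x , w) ∉ H × Reach G w y)
  zPathF-pair⇒new-edge [ s ] (_ ∷ʳ ())
  zPathF-pair⇒new-edge [ s ] (_ ∷ ())
  zPathF-pair⇒new-edge (_∷_ {u} {v} {π = ρ} e w) τ with (u , v) ∈E? H
  ... | yes _ = Product.map₂ (Product.map₁ there) (zPathF-pair⇒new-edge w τ)
  ... | no new with τ
  ...   | _ ∷ʳ τ′   = Product.map₂ (Product.map₁ there) (zPathF-pair⇒new-edge w τ′)
  ...   | refl ∷ τ′ = v , here refl , new , walk-start-reaches w (∈-zPath⁻ H forwards (v ∷ ρ) (to∈ τ′))

  zHeadsB-∈⇒new-edge : ∀ {u t ρ y} → Walk G u t (u ∷ ρ) → y ∈ zHeadsB H u ρ →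
                       ∃[ w ] ((w , y) ∈ edges (u ∷ ρ) × (w , y) ∉ H × Reach G u w)
  zHeadsB-∈⇒new-edge (_∷_ {u} {v} e w) m with (u , v) ∈E? H
  ... | yes _ = Product.map₂ (Product.map there (Product.map₂ (e ◅_))) (zHeadsB-∈⇒new-edge w m)
  ... | no new with m
  ...   | here refl = u , here refl , new , ε
  ...   | there m′  = Product.map₂ (Product.map there (Product.map₂ (e ◅_))) (zHeadsB-∈⇒new-edge w m′)

  zPathB-pair⇒new-edge : ∀ {s t π x y} → Walk G s t π → (x ∷ y ∷ []) ⊆ zPathB H π →
                         ∃[ w ] ((w , y) ∈ edges π × (w , y) ∉ H × Reach G x w)
  zPathB-pair⇒new-edge [ s ]             (_ ∷ʳ ())
  zPathB-pair⇒new-edge [ s ]             (_ ∷ ())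
  zPathB-pair⇒new-edge w@(_ ∷ _)         (refl ∷ τ) = zHeadsB-∈⇒new-edge w (to∈ τ)
  zPathB-pair⇒new-edge (_∷_ {u} {v} e w) (_ ∷ʳ τ)   with (u , v) ∈E? H
  ... | yes _ = Product.map₂ (Product.map₁ there) (zPathB-pair⇒new-edge w (v ∷ʳ τ))
  ... | no _  = Product.map₂ (Product.map₁ there) (zPathB-pair⇒new-edge w τ)

RouteVia : Mode → ∀ {n} → Graph n → Graph n → Fin n → Fin n → Set
RouteVia forwards  G K x y = ∃[ w ] ((x , w) ∈ K × Reach G w y)
RouteVia backwards G K x y = ∃[ w ] ((w , y) ∈ K × Reach G x w)

module _ {n : ℕ} {G : Graph n} where

  routeVia-mono : ∀ md {K K′ x y} → K ⊆ₛ K′ → RouteVia md G K x y → RouteVia md G K′ x y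
  routeVia-mono forwards  K⊆K′ (w , e , r) = w , K⊆K′ e , r
  routeVia-mono backwards K⊆K′ (w , e , r) = w , K⊆K′ e , r

  growth-walk : ∀ md {H s t π} → H ⊆ₛ G → Growth md G H (s , t) π → Walk G s t π
  growth-walk forwards  H⊆G = fwd-walk H⊆G
  growth-walk backwards H⊆G = bwd-walk H⊆G

  growth-routeVia : ∀ md {H s t π x y} → H ⊆ₛ G → Growth md G H (s , t) π →
                    (x ∷ y ∷ []) ⊆ zPath md H π → RouteVia md G (edges π) x y
  growth-routeVia forwards  H⊆G g τ =
    let w , e , _ , r = zPathF-pair⇒new-edge (fwd-walk H⊆G g) τ in w , e , r
  growth-routeVia backwards H⊆G g τ =
    let w , e , _ , r = zPathB-pair⇒new-edge (bwd-walk H⊆G g) τ in w , e , r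

  growth-¬routeVia : ∀ md {H s t π x y} → H ⊆ₛ G → Growth md G H (s , t) π →
                     (x ∷ y ∷ []) ⊆ zPath md H π → ¬ RouteVia md G H x y
  growth-¬routeVia forwards {H} {s} {t} {π} H⊆G g τ (w′ , h , w′↝y) =
    let _ , e , new , _ = zPathF-pair⇒new-edge walk τ in
    fwd-new-edge⇒¬H-exit g e new h (w′↝y ◅◅ walk-reaches-end walk (∈-zPath⁻ H forwards π (to∈ (∷ˡ⁻ τ))))
    where
    walk : Walk G s t π
    walk = fwd-walk H⊆G g
  growth-¬routeVia backwards {H} {s} {t} {π} H⊆G g τ (w′ , h , x↝w′) =
    let _ , e , new , _ = zPathB-pair⇒new-edge walk τ in
    bwd-new-edge⇒¬H-entry g e new h (walk-start-reaches walk (∈-zPath⁻ H backwards π (to∈ τ)) ◅◅ x↝w′)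
    where
    walk : Walk G s t π
    walk = bwd-walk H⊆G g

module _ {n : ℕ} (H : Graph n) where

  private
    dedup : Graph n → Graph n
    dedup = deduplicate (≡-dec _≟_ _≟_)

  numEdges-++ : ∀ {es} → Unique es → numEdges (H ++ es) ≡ numEdges H + length (newEdges H es)
  numEdges-++ {es} uniq = begin
    length (dedup (H ++ es))
      ≡⟨ unique-same-members⇒length≡ (deduplicate-! _ (H ++ es)) unique′ (mk⇔ to from) ⟩
    length (dedup H ++ newEdges H es)
      ≡⟨ length-++ (dedup H) ⟩
    numEdges H + length (newEdges H es) ∎
    where
    open ≡-Reasoning
    new? : ∀ e → Dec (e ∉ H)
    new? e = ¬? (e ∈E? H)
    unique′ : Unique (dedup H ++ newEdges H es)
    unique′ = Unique.++⁺ (deduplicate-! _ H) (Unique.filter⁺ new? {es} uniq)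
                (λ (old , new) → proj₂ (∈-filter⁻ new? {xs = es} new) (∈-deduplicate⁻ _ H old))
    to : ∀ {e} → e ∈ dedup (H ++ es) → e ∈ dedup H ++ newEdges H es
    to m with ∈-++⁻ H (∈-deduplicate⁻ _ (H ++ es) m)
    ... | inj₁ old = ∈-++⁺ˡ (∈-deduplicate⁺ _ old)
    ... | inj₂ e∈es with _ ∈E? H
    ...   | yes old = ∈-++⁺ˡ (∈-deduplicate⁺ _ old)
    ...   | no new  = ∈-++⁺ʳ (dedup H) (∈-filter⁺ new? e∈es new)
    from : ∀ {e} → e ∈ dedup H ++ newEdges H es → e ∈ dedup (H ++ es)
    from m with ∈-++⁻ (dedup H) m
    ... | inj₁ old = ∈-deduplicate⁺ _ (∈-++⁺ˡ (∈-deduplicate⁻ _ H old))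
    ... | inj₂ new = ∈-deduplicate⁺ _ (∈-++⁺ʳ H (proj₁ (∈-filter⁻ new? new)))

module _ (md : Mode) {n : ℕ} {G : Graph n} where

  growth-⊆ₛ : ∀ {H s t π} → H ⊆ₛ G → Growth md G H (s , t) π → H ++ edges π ⊆ₛ G
  growth-⊆ₛ {H} H⊆G g = Sum.[ H⊆G , walk-edges⊆ (growth-walk md H⊆G g) ]′ ∘ ∈-++⁻ H

  growth-size : DAG G → ∀ {H s t π} → H ⊆ₛ G → Growth md G H (s , t) π →
                numEdges H + length (zPath md H π) ≡ suc (numEdges (H ++ edges π))
  growth-size dag {H} {s} H⊆G g with walk ← growth-walk md H⊆G g | walk-head walk
  ... | ρ , refl = begin
    numEdges H + length (zPath md H (s ∷ ρ))
      ≡⟨ cong (numEdges H +_) (zPath-length H md s ρ) ⟩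
    numEdges H + suc (length (newEdges H (edges (s ∷ ρ))))
      ≡⟨ ℕ.+-suc (numEdges H) _ ⟩
    suc (numEdges H + length (newEdges H (edges (s ∷ ρ))))
      ≡⟨ cong suc (numEdges-++ H (edges-unique (walk-unique dag walk))) ⟨
    suc (numEdges (H ++ edges (s ∷ ρ))) ∎
    where open ≡-Reasoning

  run-size : DAG G → ∀ {H ds Z H′} → H ⊆ₛ G → Run md G H ds Z H′ →
             numEdges H + size Z ≡ numEdges H′ + length ds
  run-size dag H⊆G done = refl
  run-size dag {H} H⊆G (step {π = π} {ds} {Z} {H′} g run) = begin
    numEdges H + (length (zPath md H π) + size Z) ≡⟨ ℕ.+-assoc (numEdges H) _ _ ⟨
    (numEdges H + length (zPath md H π)) + size Z ≡⟨ cong (_+ size Z) (growth-size dag H⊆G g) ⟩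
    suc (numEdges (H ++ edges π) + size Z)        ≡⟨ cong suc (run-size dag (growth-⊆ₛ H⊆G g) run) ⟩
    suc (numEdges H′ + length ds)                 ≡⟨ ℕ.+-suc (numEdges H′) _ ⟨
    numEdges H′ + suc (length ds)                 ∎
    where open ≡-Reasoning

  run-AllPairs : ∀ {R : Rel (Fin n) r} → Transitive R → (∀ {u v} → (u , v) ∈ G → R u v) →
                 ∀ {H ds Z H′} → H ⊆ₛ G → Run md G H ds Z H′ → All (AllPairs R) Z
  run-AllPairs R-trans edge H⊆G done = []
  run-AllPairs R-trans edge {H} H⊆G (step {π = π} g run) =
    AllPairs-resp-⊆ (zPath-⊆ H md π) (walk⇒AllPairs R-trans edge (growth-walk md H⊆G g)) ∷
    run-AllPairs R-trans edge (growth-⊆ₛ H⊆G g) run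

  run-¬routeVia : ∀ {H ds Z H′ q x y} → H ⊆ₛ G → Run md G H ds Z H′ → Any (q ⊆_) Z →
                  (x ∷ y ∷ []) ⊆ q → ∃[ K ] (H ⊆ₛ K × ¬ RouteVia md G K x y)
  run-¬routeVia {H} H⊆G (step g run) (here q⊆z) τ =
    H , id , growth-¬routeVia md H⊆G g (⊆-trans τ q⊆z)
  run-¬routeVia H⊆G (step g run) (there later) τ =
    let K , H⊆K , noRoute = run-¬routeVia (growth-⊆ₛ H⊆G g) run later τ in
    K , H⊆K ∘ ∈-++⁺ˡ , noRoute

  run-ordered-routeVia : ∀ {H ds Z H′ p q x y x′ y′} → H ⊆ₛ G → Run md G H ds Z H′ →
                         Hetero.Sublist _⊆_ (p ∷ q ∷ []) Z → (x ∷ y ∷ []) ⊆ p → (x′ ∷ y′ ∷ []) ⊆ q →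
                         ∃[ K ] (RouteVia md G K x y × ¬ RouteVia md G K x′ y′)
  run-ordered-routeVia H⊆G (step g run) (_ ∷ʳ σ) τ τ′ =
    run-ordered-routeVia (growth-⊆ₛ H⊆G g) run σ τ τ′
  run-ordered-routeVia {H} H⊆G (step g run) (p⊆z ∷ σ) τ τ′ =
    let K , H⊆K , noRoute = run-¬routeVia (growth-⊆ₛ H⊆G g) run (Hetero.toAny σ) τ′ in
    K , routeVia-mono md (H⊆K ∘ ∈-++⁺ʳ H) (growth-routeVia md H⊆G g (⊆-trans τ p⊆z)) , noRoute

-- Bridges

module _ {n : ℕ} where

  deletion-⊆ : ∀ {S S′ : PathSystem n} → S ⇝ S′ → Hetero.Sublist _⊆_ (proj₂ S′) (proj₂ S)
  deletion-⊆ (delPath {π = π})          =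
    Hetero.++⁺ (Hetero.refl ⊆-refl) (π Hetero.∷ʳ Hetero.refl ⊆-refl)
  deletion-⊆ (delNode {x = x} {ps = ps}) = map-⊆ (filter-⊆ (λ y → ¬? (y ≟ x))) ps
  deletion-⊆ (delOcc {π = π} j)          =
    Hetero.++⁺ (Hetero.refl ⊆-refl) (removeAt-⊆ π j Hetero.∷ Hetero.refl ⊆-refl)

  subsystem-⊆ : ∀ {S S′ : PathSystem n} → Subsystem S S′ → Hetero.Sublist _⊆_ (proj₂ S′) (proj₂ S)
  subsystem-⊆ ε          = Hetero.refl ⊆-refl
  subsystem-⊆ (del ◅ ss) = Hetero.trans ⊆-trans (subsystem-⊆ ss) (deletion-⊆ del)

module _ {n : ℕ} {G : Graph n} {md : Mode} {ds : List (Fin n × Fin n)} {Z : List (List (Fin n))}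
         {H : Graph n} (run : Run md G [] ds Z H)
         {m : ℕ} {S′ : PathSystem n} (sub : Subsystem (allFin n , Z) S′) (b : Bridge m S′) where

  open Bridge b

  private
    paths-reach : All (AllPairs (Reach G)) (proj₂ S′)
    paths-reach =
      All-resp-Sublist AllPairs-resp-⊆ (subsystem-⊆ sub) (run-AllPairs md _◅◅_ (_◅ ε) []⊆ₛ run)

  arc-reach : ∀ i → Reach G (node (inject₁ i)) (node (suc i))
  arc-reach i with subst (AllPairs (Reach G)) (arc i) (All.lookup paths-reach (∈-lookup (slot (suc i))))
  ... | (x↝y ∷ []) ∷ _ = x↝y

  arc-before-river : ∀ {i} → slot (suc i) F.< slot zero →
                     ∃[ K ] (RouteVia md G K (node (inject₁ i)) (node (suc i)) ×
                             ¬ RouteVia md G K (node zero) (node (fromℕ (suc m))))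
  arc-before-river {i} arc<river =
    run-ordered-routeVia md []⊆ₛ run
      (Hetero.trans (λ { refl τ → τ }) (lookup-⊆ arc<river) (subsystem-⊆ sub))
      (⊆-reflexive (sym (arc i))) (⊆-reflexive (sym river))

no-bad-bridge : ∀ md {n} {G : Graph n} {ds Z H} → Run md G [] ds Z H →
                ¬ ContainsBadBridge md (allFin n , Z)
no-bad-bridge forwards run (_ , sub , m , b , first<river) =
  let _ , (w , e , w↝x₂) , noRoute = arc-before-river run sub b first<river in
  noRoute (w , e , w↝x₂ ◅◅ Star-chain m (node ∘ suc) (arc-reach run sub b ∘ suc))
  where open Bridge b
no-bad-bridge backwards run (_ , sub , m , b , last<river) =
  let _ , (w , e , x↝w) , noRoute = arc-before-river run sub b last<river in
  noRoute (w , e , Star-chain m (node ∘ inject₁) (arc-reach run sub b ∘ inject₁) ◅◅ x↝w)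
  where open Bridge b

lemma11 : ∀ {n} (G : Graph n) → DAG G →
          (ds : List (Fin n × Fin n)) →
          All (λ d → Reach G (proj₁ d) (proj₂ d)) ds →
          (md : Mode) (Z : List (List (Fin n))) (H : Graph n) →
          Run md G [] ds Z H →
          Acyclic Z × (size Z ≡ numEdges H + length ds)
            × ¬ ContainsBadBridge md (allFin n , Z)
lemma11 G dag ds _ md Z H run =
  (_≺_ G , ≺-isStrictTotalOrder G , run-AllPairs md ≺-trans (≺-edge G dag) []⊆ₛ run) ,
  run-size md dag []⊆ₛ run ,
  no-bad-bridge md run
  where
  ≺-trans : Transitive (_≺_ G)
  ≺-trans = IsStrictTotalOrder.trans (≺-isStrictTotalOrder G)
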